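{- Let $E$ be a finite set, $\mathcal{L}$ a set of subsets of $E$, and suppose $T(\mathcal{L})$ acts transitively on $\mathcal{L}$. Let $X$ and $Y$ be disjoint subsets of $E$ and let $\sigma=\tau_{x_1}\cdots\tau_{x_m}$ and $\rho=\tau_{y_1}\cdots\tau_{y_\ell}$ where each $x_i\in X$ and each $y_j\in Y$. Then for every $A\in\mathcal{L}$, $\sigma(A)=\rho(A)$ if and only if $\sigma(A)=A=\rho(A)$.
   Context: For $e\in E$, the toggle $\tau_e:\mathcal{L}\to\mathcal{L}$ is defined by $\tau_e(X)=X\triangle\{e\}$ if $X\triangle\{e\}\in\mathcal{L}$, and $\tau_e(X)=X$ otherwise. The toggle group $T(\mathcal{L})$ is the subgroup of the symmetric group on $\mathcal{L}$ generated by $\{\tau_e: e\in E\}$. -}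

module Defs where

open import Data.Nat using (ℕ)
open import Data.Bool using (Bool; _xor_; if_then_else_)
open import Data.Fin using (Fin)
open import Data.Fin.Subset using (Subset; ⁅_⁆)
open import Data.List using (List; []; _∷_)
open import Data.Vec using (zipWith)
open import Relation.Unary using (Pred; Decidable)
open import Relation.Nullary using (does)
open import Level using (0ℓ)

_△_ : ∀ {n} → Subset n → Subset n → Subset n
X △ Y = zipWith _xor_ X Y

toggle : ∀ {n} (𝓛 : Pred (Subset n) 0ℓ) → Decidable 𝓛 → Fin n → Subset n → Subset n
toggle 𝓛 𝓛? e X = if does (𝓛? (X △ ⁅ e ⁆)) then X △ ⁅ e ⁆ else X

-- The product τ_{e₁} ⋯ τ_{e_k} (composition; τ_{e_k} applied first).
toggles : ∀ {n} (𝓛 : Pred (Subset n) 0ℓ) → Decidable 𝓛 → List (Fin n) → Subset n → Subset n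
toggles 𝓛 𝓛? []       X = X
toggles 𝓛 𝓛? (e ∷ es) X = toggle 𝓛 𝓛? e (toggles 𝓛 𝓛? es X)

-- T(𝓛) acts transitively on 𝓛. Since every element of T(𝓛) is a product of
-- toggles (each toggle is an involution), this says any two members of 𝓛
-- are related by some word in the toggles.
Transitive : ∀ {n} (𝓛 : Pred (Subset n) 0ℓ) → Decidable 𝓛 → Set
Transitive {n} 𝓛 𝓛? =
  ∀ A B → 𝓛 A → 𝓛 B → Data.Product.∃ λ (w : List (Fin n)) → toggles 𝓛 𝓛? w A Relation.Binary.PropositionalEquality.≡ B
  where import Data.Product
        import Relation.Binary.PropositionalEquality

-- A toggle τ_e only ever changes membership of e, so a word in toggles from X
-- leaves every coordinate outside X untouched, and likewise for Y.  If
-- σ(A) = ρ(A), then σ(A) agrees with A outside X, and inside X (which is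
-- outside Y) it agrees with ρ(A), hence again with A.
module Submission where

open import Defs
open import Data.Nat using (ℕ)
open import Data.Bool using (true; false; _xor_)
open import Data.Bool.Properties using (¬-not; xor-identityʳ)
open import Data.Fin using (Fin)
open import Data.Fin.Subset using (Subset; _∈_; _∉_; _∩_; Empty; ⁅_⁆)
open import Data.Fin.Subset.Properties using (_∈?_; x∈p∩q⁺; x≢y⇒x∉⁅y⁆)
open import Data.List using (List; []; _∷_)
open import Data.List.Relation.Unary.All using (All; []; _∷_)
open import Data.Product using (_×_; _,_)
open import Data.Vec using (lookup)
open import Data.Vec.Properties using (lookup-zipWith; lookup⇒[]=)
open import Data.Vec.Relation.Binary.Pointwise.Extensional using (ext; Pointwise-≡⇒≡)
open import Relation.Unary using (Pred; Decidable)
open import Relation.Nullary using (does; yes; no)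
open import Relation.Binary.PropositionalEquality
open import Function.Bundles using (_⇔_; mk⇔)
open import Level using (0ℓ)

lookup-⁅⁆-≢ : ∀ {n} {i e : Fin n} → i ≢ e → lookup ⁅ e ⁆ i ≡ false
lookup-⁅⁆-≢ {e = e} i≢e = ¬-not (λ eq → x≢y⇒x∉⁅y⁆ i≢e (lookup⇒[]= _ ⁅ e ⁆ eq))

lookup-△-⁅⁆-≢ : ∀ {n} (A : Subset n) {i e : Fin n} → i ≢ e →
                lookup (A △ ⁅ e ⁆) i ≡ lookup A i
lookup-△-⁅⁆-≢ A {i} {e} i≢e = begin
  lookup (A △ ⁅ e ⁆) i           ≡⟨ lookup-zipWith _xor_ i A ⁅ e ⁆ ⟩
  lookup A i xor lookup ⁅ e ⁆ i  ≡⟨ cong (lookup A i xor_) (lookup-⁅⁆-≢ i≢e) ⟩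
  lookup A i xor false           ≡⟨ xor-identityʳ _ ⟩
  lookup A i                     ∎
  where open ≡-Reasoning

module _ {n} (𝓛 : Pred (Subset n) 0ℓ) (𝓛? : Decidable 𝓛) where

  lookup-toggle-≢ : (A : Subset n) {i e : Fin n} → i ≢ e →
                    lookup (toggle 𝓛 𝓛? e A) i ≡ lookup A i
  lookup-toggle-≢ A {e = e} i≢e with does (𝓛? (A △ ⁅ e ⁆))
  ... | true  = lookup-△-⁅⁆-≢ A i≢e
  ... | false = refl

  lookup-toggles-∉ : {S : Subset n} {es : List (Fin n)} → All (_∈ S) es →
                     (A : Subset n) {i : Fin n} → i ∉ S →
                     lookup (toggles 𝓛 𝓛? es A) i ≡ lookup A i
  lookup-toggles-∉ []                  A i∉S = refl
  lookup-toggles-∉ {es = e ∷ es} (e∈S ∷ es⊆S) A {i} i∉S = trans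
    (lookup-toggle-≢ (toggles 𝓛 𝓛? es A) (λ { refl → i∉S e∈S }))
    (lookup-toggles-∉ es⊆S A i∉S)

≡-of-disjoint-changes : ∀ {n} {X Y : Subset n} → Empty (X ∩ Y) → (A B C : Subset n) →
  (∀ {i} → i ∉ X → lookup B i ≡ lookup A i) →
  (∀ {i} → i ∉ Y → lookup C i ≡ lookup A i) →
  B ≡ C → B ≡ A
≡-of-disjoint-changes {X = X} X∩Y≡∅ A B C B≈A∖X C≈A∖Y B≡C =
  Pointwise-≡⇒≡ (ext agree)
  where
  agree : ∀ i → lookup B i ≡ lookup A i
  agree i with i ∈? X
  ... | no  i∉X = B≈A∖X i∉X
  ... | yes i∈X = trans (cong (λ D → lookup D i) B≡C)
                        (C≈A∖Y (λ i∈Y → X∩Y≡∅ (i , x∈p∩q⁺ (i∈X , i∈Y))))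

lemma2p5 : (n : ℕ) (𝓛 : Pred (Subset n) 0ℓ) (𝓛? : Decidable 𝓛) →
    Transitive 𝓛 𝓛? →
    (X Y : Subset n) → Empty (X ∩ Y) →
    (xs ys : List (Fin n)) → All (_∈ X) xs → All (_∈ Y) ys →
    (A : Subset n) → 𝓛 A →
    (toggles 𝓛 𝓛? xs A ≡ toggles 𝓛 𝓛? ys A) ⇔
      (toggles 𝓛 𝓛? xs A ≡ A × A ≡ toggles 𝓛 𝓛? ys A)
lemma2p5 n 𝓛 𝓛? _ X Y X∩Y≡∅ xs ys xs⊆X ys⊆Y A _ =
  mk⇔ (λ σA≡ρA → let σA≡A = σA≡A-of σA≡ρA in σA≡A , trans (sym σA≡A) σA≡ρA)
      (λ { (σA≡A , A≡ρA) → trans σA≡A A≡ρA })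
  where
  σA≡A-of : toggles 𝓛 𝓛? xs A ≡ toggles 𝓛 𝓛? ys A → toggles 𝓛 𝓛? xs A ≡ A
  σA≡A-of = ≡-of-disjoint-changes X∩Y≡∅ A _ _
    (lookup-toggles-∉ 𝓛 𝓛? xs⊆X A) (lookup-toggles-∉ 𝓛 𝓛? ys⊆Y A)
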